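{- Let $k$ be a positive integer and let $A=\{x_1\cdot a_1,\ldots,x_n\cdot a_n\}$ and $B=\{y_1\cdot b_1,\ldots,y_m\cdot b_m\}$ be multisets, where the $a_i$ are pairwise distinct positive integers, the $b_j$ are pairwise distinct positive integers, $1\leq a_i,b_j\leq k$ for all $i,j$, and $x_i>0$, $y_j>0$ are the multiplicities of $a_i$ in $A$ and of $b_j$ in $B$ respectively. Suppose that $\{A,B\}$ is a $k$-irreducible pair with $|A|+|B|>2$. (i) If $\{C,D\}$ is $(a_i,b_j)$-derived from $\{A,B\}$ for some $1\le i\le n$, $1\le j\le m$, then $\{C,D\}$ is $k$-irreducible. (ii) Let $p,q,u,v$ be integers with $1\le p\le q\le n$ and $1\le u\le v\le m$, and let $z_{ij}\geq 0$ be integers for $p\leq i\leq q$ and $u\leq j\leq v$, such that $\sum_{j=u}^v z_{ij}\leq x_i$ for each $i$ and $\sum_{i=p}^q z_{ij}\leq y_j$ for each $j$. If $\{C,D\}$ is $\prod_{i=p}^q\prod_{j=u}^v (a_i,b_j)^{z_{ij}}$-derived from $\{A,B\}$, then $\{C,D\}$ is $k$-irreducible.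
   Context: For a finite multiset $S$, $|S|$ is the number of elements of $S$ counted with multiplicity, $\max(S)$ is its largest element, and $\Sigma S=\sum_{s\in S}s$ (with multiplicity); $\{x\cdot a\}$ denotes $x$ copies of $a$. For nonempty finite multisets $A,B$ of positive integers, the pair $\{A,B\}$ is called irreducible if $\Sigma A=\Sigma B$ and for every nonempty proper multisubsets $A'\subsetneq A$ and $B'\subsetneq B$ one has $\Sigma A'\neq \Sigma B'$; it is $k$-irreducible if moreover $\max(A\cup B)\leq k$. Given $a_i\in A$, $b_j\in B$, the pair $\{C,D\}$ is $(a_i,b_j)$-derived from $\{A,B\}$ if $C$ is obtained from $A$ by removing one copy of $a_i$ and adding one copy of $a_i-b_j$ when $a_i>b_j$, and $D$ is obtained from $B$ by removing one copy of $b_j$ and adding one copy of $b_j-a_i$ when $b_j>a_i$. The pair $\{C,D\}$ is $\prod_{i=p}^q\prod_{j=u}^v (a_i,b_j)^{z_{ij}}$-derived from $\{A,B\}$ if it is obtained by performing on $\{A,B\}$, for each pair $(i,j)$, an $(a_i,b_j)$-derivation $z_{ij}$ times, each time removing a copy of the original element $a_i$ of $A$ and a copy of the original element $b_j$ of $B$ (no derivation when $z_{ij}=0$); equivalently, $C$ is obtained from $A$ by removing $\sum_j z_{ij}$ copies of $a_i$ for each $i$ and adding $z_{ij}$ copies of $a_i-b_j$ for each $(i,j)$ with $a_i>b_j$, and $D$ is obtained from $B$ by removing $\sum_i z_{ij}$ copies of $b_j$ for each $j$ and adding $z_{ij}$ copies of $b_j-a_i$ for each $(i,j)$ with $b_j>a_i$.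 -}

module Defs where

open import Data.Nat using (ℕ; zero; suc; _+_; _*_; _∸_; _≤_; _<_; _<?_)
open import Data.Fin using (Fin; toℕ)
open import Data.Nat.ListAction using (sum)
open import Data.List using (List; []; _∷_; _++_; length; map; replicate; concatMap; allFin)
open import Data.List.Relation.Binary.Sublist.Propositional using (_⊆_)
open import Data.List.Relation.Binary.Permutation.Propositional using (_↭_)
open import Data.List.Relation.Unary.All using (All)
open import Data.Product using (_×_; ∃)
open import Relation.Nullary using (¬_; does)
open import Data.Bool using (if_then_else_)
open import Relation.Binary.PropositionalEquality using (_≡_)

-- Finite multisets of natural numbers are represented by lists (up to _↭_);
-- multisubsets of a multiset L are exactly the sublists L' ⊆ L.
-- |L| = length L, ΣL = sum L.

PosMultiset : List ℕ → Set
PosMultiset L = 0 < length L × All (0 <_) L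

Irreducible : List ℕ → List ℕ → Set
Irreducible A B =
  PosMultiset A × PosMultiset B × sum A ≡ sum B ×
  (∀ A' B' → A' ⊆ A → B' ⊆ B →
     0 < length A' → length A' < length A →
     0 < length B' → length B' < length B →
     ¬ (sum A' ≡ sum B'))

KIrreducible : ℕ → List ℕ → List ℕ → Set
KIrreducible k A B = Irreducible A B × All (_≤ k) (A ++ B)

diffIfGt : ℕ → ℕ → List ℕ
diffIfGt a b = if does (b <? a) then (a ∸ b) ∷ [] else []

Derived1 : ℕ → ℕ → List ℕ → List ℕ → List ℕ → List ℕ → Set
Derived1 a b A B C D =
  ∃ λ A₀ → ∃ λ B₀ → (A ↭ a ∷ A₀) × (B ↭ b ∷ B₀) ×
    (C ↭ A₀ ++ diffIfGt a b) × (D ↭ B₀ ++ diffIfGt b a)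

mset : ∀ {n} → (Fin n → ℕ) → (Fin n → ℕ) → List ℕ
mset {n} a x = concatMap (λ i → replicate (x i) (a i)) (allFin n)

ΣFin : ∀ n → (Fin n → ℕ) → ℕ
ΣFin n f = sum (map f (allFin n))

-- i lies in the (0-based) index range [p, q]
InRange : ∀ {n} → Fin n → Fin n → Fin n → Set
InRange p q i = toℕ p ≤ toℕ i × toℕ i ≤ toℕ q

inRange? : ∀ {n} → Fin n → Fin n → Fin n → Data.Bool.Bool
inRange? p q i = does (toℕ i <? suc (toℕ q)) Data.Bool.∧ does (toℕ p <? suc (toℕ i))
  where import Data.Bool

zR : ∀ {n m} → Fin n → Fin n → Fin m → Fin m → (Fin n → Fin m → ℕ) → Fin n → Fin m → ℕ
zR p q u v z i j = if inRange? p q i then (if inRange? u v j then z i j else 0) else 0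

derivedC : ∀ {n m} → (Fin n → ℕ) → (Fin n → ℕ) → (Fin m → ℕ) →
           (Fin n → Fin m → ℕ) → List ℕ
derivedC {n} {m} a x b z =
  concatMap (λ i → replicate (x i ∸ ΣFin m (z i)) (a i)) (allFin n) ++
  concatMap (λ i → concatMap (λ j →
     concatMap (λ _ → diffIfGt (a i) (b j)) (replicate (z i j) 0)) (allFin m)) (allFin n)

DerivedProd : ∀ {n m} → (a x : Fin n → ℕ) → (b y : Fin m → ℕ) →
  (p q : Fin n) → (u v : Fin m) → (z : Fin n → Fin m → ℕ) → List ℕ → List ℕ → Set
DerivedProd a x b y p q u v z C D =
  (C ↭ derivedC a x b (zR p q u v z)) ×
  (D ↭ derivedC b y a (λ j i → zR p q u v z i j))

module Submission where

-- Forget, for the moment, that an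
-- irreducible pair consists of NONEMPTY multisets: call {A,B} k-balanced if
-- all entries lie in [1,k], ΣA = ΣB and no proper nonempty parts A' ⊊ A,
-- B' ⊊ B have equal sums.
--
--  * Being k-balanced is invariant under permutation and symmetric, and one
--    (a,b)-derivation of a k-balanced pair is k-balanced: a splitting of the
--    derived pair that uses the new element a - b becomes a splitting of the
--    old pair after trading a - b for a and adding b to the other side.
--  * Hence performing derivations along any list P of pairs (a,b), each time
--    consuming a copy of a from A and a copy of b from B, keeps the pair
--    k-balanced (induction on P).  If |A| + |B| > 2 the result is nonempty:
--    otherwise every pair in P has a = b, so A is a rearrangement of B with
--    at least two elements, and its first element splits {A,B}.
--  * The indexed derivation ∏ (a_i,b_j)^{z_ij} is the list derivation along
--    the list of pairs (a_i,b_j) repeated z_ij times; this is list algebra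
--    about concatMap and replicate.

open import Defs
open import Data.Nat using (ℕ; zero; suc; _+_; _∸_; _≤_; _<_; z≤n; s≤s; _<?_)
open import Data.Nat.Properties
  using (≤-pred; ≤-trans; ≤-antisym; n≤1+n; <⇒≤; <-irrefl; ≮⇒≥; <-cmp;
         m∸n≤m; m<n⇒0<n∸m; m+[n∸m]≡n; +-assoc; +-cancelˡ-≡)
open import Data.Nat.ListAction using (sum)
open import Data.Nat.ListAction.Properties using (sum-↭)
open import Data.Fin using (Fin; toℕ)
open import Data.Bool using (true; false; _∧_)
open import Data.Empty using (⊥; ⊥-elim)
open import Data.Product using (_×_; _,_; ∃; proj₁; proj₂) renaming (swap to swap-pair)
open import Data.List using (List; []; _∷_; [_]; _++_; length; map; replicate; concatMap; allFin)
open import Data.List.Properties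
  using (++-assoc; ++-identityʳ; map-∘; map-concatMap; map-replicate; concatMap-++;
         concatMap-cong; concatMap-map)
open import Data.List.Relation.Binary.Sublist.Propositional using (_⊆_; []; _∷_; _∷ʳ_)
open import Data.List.Relation.Binary.Permutation.Propositional
  using (_↭_; refl; prep; swap; trans; ↭-refl; ↭-sym; ↭-trans; ↭-reflexive)
open import Data.List.Relation.Binary.Permutation.Propositional.Properties
  using (↭-length; ↭-empty-inv; ↭-singleton-inv; All-resp-↭; map⁺; ++⁺ˡ; ++⁺ʳ; shifts)
  renaming (++-comm to ↭-++-comm)
open import Data.List.Relation.Unary.All using (All; []; _∷_)
import Data.List.Relation.Unary.All.Properties as All
open import Relation.Binary using (tri<; tri≈; tri>)
open import Relation.Binary.PropositionalEquality
  using (_≡_; refl; sym; cong; cong₂; subst; subst₂; module ≡-Reasoning)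
  renaming (trans to ≡-trans)
open import Relation.Nullary using (¬_; Dec; yes; does)
open import Relation.Nullary.Decidable using (dec-true; dec-false)

private variable X Y Z : Set

-- A sublist S of L is carried along a permutation L ↭ M to a sublist of M
-- with the same elements; irreducibility quantifies over sublists, so this
-- is what makes it a property of multisets rather than of lists.
⊆-along-↭ : {L M S : List X} → L ↭ M → S ⊆ L → ∃ λ S' → S' ⊆ M × S' ↭ S
⊆-along-↭ {S = S} refl s = S , s , ↭-refl
⊆-along-↭ (prep x p) (.x ∷ʳ s) with S' , s' , σ ← ⊆-along-↭ p s = S' , x ∷ʳ s' , σ
⊆-along-↭ (prep x p) (refl ∷ s) with S' , s' , σ ← ⊆-along-↭ p s = x ∷ S' , refl ∷ s' , prep x σ
⊆-along-↭ (swap x y p) (.x ∷ʳ (.y ∷ʳ s)) with S' , s' , σ ← ⊆-along-↭ p s =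
  S' , y ∷ʳ (x ∷ʳ s') , σ
⊆-along-↭ (swap x y p) (.x ∷ʳ (refl ∷ s)) with S' , s' , σ ← ⊆-along-↭ p s =
  y ∷ S' , refl ∷ (x ∷ʳ s') , prep y σ
⊆-along-↭ (swap x y p) (refl ∷ (.y ∷ʳ s)) with S' , s' , σ ← ⊆-along-↭ p s =
  x ∷ S' , y ∷ʳ (refl ∷ s') , prep x σ
⊆-along-↭ (swap x y p) (refl ∷ (refl ∷ s)) with S' , s' , σ ← ⊆-along-↭ p s =
  y ∷ x ∷ S' , refl ∷ (refl ∷ s') , swap y x σ
⊆-along-↭ (trans p q) s with S₁ , s₁ , σ₁ ← ⊆-along-↭ p s with S₂ , s₂ , σ₂ ← ⊆-along-↭ q s₁ =
  S₂ , s₂ , ↭-trans σ₂ σ₁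

NoProperSplit : List ℕ → List ℕ → Set
NoProperSplit A B = ∀ A' B' → A' ⊆ A → B' ⊆ B →
  0 < length A' → length A' < length A →
  0 < length B' → length B' < length B →
  ¬ (sum A' ≡ sum B')

record Balanced (k : ℕ) (A B : List ℕ) : Set where
  constructor balanced
  field
    positiveA : All (0 <_) A
    positiveB : All (0 <_) B
    boundedA  : All (_≤ k) A
    boundedB  : All (_≤ k) B
    sums      : sum A ≡ sum B
    noSplit   : NoProperSplit A B

open Balanced

KIrreducible⇒Balanced : ∀ {k A B} → KIrreducible k A B → Balanced k A B
KIrreducible⇒Balanced {A = A} (((_ , posA) , (_ , posB) , sums , noSplit) , bounded) =
  balanced posA posB (All.++⁻ˡ A bounded) (All.++⁻ʳ A bounded) sums noSplit

Balanced⇒KIrreducible : ∀ {k A B} → Balanced k A B → 0 < length A → 0 < length B →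
  KIrreducible k A B
Balanced⇒KIrreducible (balanced posA posB bA bB sums noSplit) neA neB =
  ((neA , posA) , (neB , posB) , sums , noSplit) , All.++⁺ bA bB

Balanced-sym : ∀ {k A B} → Balanced k A B → Balanced k B A
Balanced-sym (balanced posA posB bA bB sums noSplit) =
  balanced posB posA bB bA (sym sums)
    (λ B' A' sB sA 0<B' B'⊊B 0<A' A'⊊A eq → noSplit A' B' sA sB 0<A' A'⊊A 0<B' B'⊊B (sym eq))

NoProperSplit-↭ : ∀ {A B A₂ B₂} → NoProperSplit A B → A ↭ A₂ → B ↭ B₂ → NoProperSplit A₂ B₂
NoProperSplit-↭ noSplit σA σB A' B' sA sB 0<A' A'⊊A 0<B' B'⊊B eq
  with A'' , sA' , τA ← ⊆-along-↭ (↭-sym σA) sA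
     | B'' , sB' , τB ← ⊆-along-↭ (↭-sym σB) sB =
  noSplit A'' B'' sA' sB'
    (subst (0 <_) (sym (↭-length τA)) 0<A')
    (subst₂ _<_ (sym (↭-length τA)) (sym (↭-length σA)) A'⊊A)
    (subst (0 <_) (sym (↭-length τB)) 0<B')
    (subst₂ _<_ (sym (↭-length τB)) (sym (↭-length σB)) B'⊊B)
    (≡-trans (sum-↭ τA) (≡-trans eq (sym (sum-↭ τB))))

Balanced-↭ : ∀ {k A B A₂ B₂} → Balanced k A B → A ↭ A₂ → B ↭ B₂ → Balanced k A₂ B₂
Balanced-↭ (balanced posA posB bA bB sums noSplit) σA σB =
  balanced (All-resp-↭ σA posA) (All-resp-↭ σB posB) (All-resp-↭ σA bA) (All-resp-↭ σB bB)
    (≡-trans (sym (sum-↭ σA)) (≡-trans sums (sum-↭ σB))) (NoProperSplit-↭ noSplit σA σB)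

-- b < a: replace a by a - b and drop b.  A splitting using a - b becomes,
-- after trading a - b for a and adding b to the other part, a splitting of
-- the original pair.
derive-gt : ∀ {k a b A₀ B₀} → Balanced k (a ∷ A₀) (b ∷ B₀) → b < a →
  Balanced k ((a ∸ b) ∷ A₀) B₀
derive-gt {a = a} {b} {A₀} {B₀} (balanced (_ ∷ posA) (_ ∷ posB) (a≤k ∷ bA) (_ ∷ bB) sums noSplit) b<a =
  balanced (m<n⇒0<n∸m b<a ∷ posA) posB (≤-trans (m∸n≤m a b) a≤k ∷ bA) bB sums' noSplit'
  where
  open ≡-Reasoning
  trade : ∀ S → b + (a ∸ b + S) ≡ a + S
  trade S = ≡-trans (sym (+-assoc b (a ∸ b) S)) (cong (_+ S) (m+[n∸m]≡n (<⇒≤ b<a)))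
  sums' : a ∸ b + sum A₀ ≡ sum B₀
  sums' = +-cancelˡ-≡ b _ _ (≡-trans (trade (sum A₀)) sums)
  noSplit' : NoProperSplit ((a ∸ b) ∷ A₀) B₀
  noSplit' A' B' (_ ∷ʳ sA) sB 0<A' A'⊊A 0<B' B'⊊B eq =
    noSplit A' B' (a ∷ʳ sA) (b ∷ʳ sB) 0<A' A'⊊A 0<B' (≤-trans B'⊊B (n≤1+n _)) eq
  noSplit' (_ ∷ A') B' (refl ∷ sA) sB _ A'⊊A _ B'⊊B eq =
    noSplit (a ∷ A') (b ∷ B') (refl ∷ sA) (refl ∷ sB) (s≤s z≤n) A'⊊A (s≤s z≤n) (s≤s B'⊊B)
      (begin
        a + sum A'             ≡⟨ sym (trade (sum A')) ⟩
        b + (a ∸ b + sum A')   ≡⟨ cong (b +_) eq ⟩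
        b + sum B'             ∎)

derive-eq : ∀ {k a A₀ B₀} → Balanced k (a ∷ A₀) (a ∷ B₀) → Balanced k A₀ B₀
derive-eq {a = a} (balanced (_ ∷ posA) (_ ∷ posB) (_ ∷ bA) (_ ∷ bB) sums noSplit) =
  balanced posA posB bA bB (+-cancelˡ-≡ a _ _ sums)
    (λ A' B' sA sB 0<A' A'⊊A 0<B' B'⊊B →
       noSplit A' B' (a ∷ʳ sA) (a ∷ʳ sB) 0<A' (≤-trans A'⊊A (n≤1+n _)) 0<B' (≤-trans B'⊊B (n≤1+n _)))

diffIfGt-yes : ∀ {a b} → b < a → diffIfGt a b ≡ [ a ∸ b ]
diffIfGt-yes {a} {b} b<a rewrite dec-true (b <? a) b<a = refl

diffIfGt-no : ∀ {a b} → ¬ (b < a) → diffIfGt a b ≡ []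
diffIfGt-no {a} {b} b≮a rewrite dec-false (b <? a) b≮a = refl

diffIfGt-empty : ∀ {a b} → diffIfGt a b ≡ [] → a ≤ b
diffIfGt-empty empty = ≮⇒≥ λ b<a → [c]≢[] (≡-trans (sym (diffIfGt-yes b<a)) empty)
  where
  [c]≢[] : ∀ {c : ℕ} → [ c ] ≡ [] → ⊥
  [c]≢[] ()

derive-one : ∀ {k a b A₀ B₀} → Balanced k (a ∷ A₀) (b ∷ B₀) →
  Balanced k (A₀ ++ diffIfGt a b) (B₀ ++ diffIfGt b a)
derive-one {a = a} {b} {A₀} {B₀} bal with <-cmp a b
... | tri< a<b _ b≮a rewrite diffIfGt-no b≮a | diffIfGt-yes a<b =
  Balanced-sym (Balanced-↭ (derive-gt (Balanced-sym bal) a<b)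
    (↭-++-comm [ b ∸ a ] B₀) (↭-reflexive (sym (++-identityʳ A₀))))
... | tri≈ _ refl _ rewrite diffIfGt-no {a} {a} (<-irrefl refl) =
  Balanced-↭ (derive-eq bal) (↭-reflexive (sym (++-identityʳ A₀))) (↭-reflexive (sym (++-identityʳ B₀)))
... | tri> a≮b _ b<a rewrite diffIfGt-yes b<a | diffIfGt-no a≮b =
  Balanced-↭ (derive-gt bal b<a) (↭-++-comm [ a ∸ b ] A₀) (↭-reflexive (sym (++-identityʳ B₀)))

leftDiff rightDiff : ℕ × ℕ → List ℕ
leftDiff  (a , b) = diffIfGt a b
rightDiff (a , b) = diffIfGt b a

derive-many : ∀ {k A B} P A₀ B₀ → Balanced k A B →
  A ↭ map proj₁ P ++ A₀ → B ↭ map proj₂ P ++ B₀ →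
  Balanced k (A₀ ++ concatMap leftDiff P) (B₀ ++ concatMap rightDiff P)
derive-many [] A₀ B₀ bal σA σB =
  Balanced-↭ bal (↭-trans σA (↭-reflexive (sym (++-identityʳ A₀))))
                 (↭-trans σB (↭-reflexive (sym (++-identityʳ B₀))))
derive-many ((a , b) ∷ P) A₀ B₀ bal σA σB =
  Balanced-↭
    (derive-many P (A₀ ++ diffIfGt a b) (B₀ ++ diffIfGt b a) (derive-one (Balanced-↭ bal σA σB))
      (↭-reflexive (++-assoc (map proj₁ P) A₀ _)) (↭-reflexive (++-assoc (map proj₂ P) B₀ _)))
    (↭-reflexive (++-assoc A₀ _ _)) (↭-reflexive (++-assoc B₀ _ _))

[]⊆ : ∀ (L : List ℕ) → [] ⊆ L
[]⊆ []      = []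
[]⊆ (c ∷ L) = c ∷ʳ []⊆ L

++-empty : ∀ (xs : List ℕ) {ys} → xs ++ ys ≡ [] → xs ≡ [] × ys ≡ []
++-empty [] e = refl , e

-- A rearrangement of a multiset with at least two elements is not
-- irreducible against it: its first element alone is a splitting.
rearrangement-splits : ∀ {A B} → NoProperSplit A B → A ↭ B → 1 < length A → ⊥
rearrangement-splits {a ∷ A} {B} noSplit σ 1<|A|
  with S , S⊆B , S↭[a] ← ⊆-along-↭ σ (refl ∷ []⊆ A) rewrite ↭-singleton-inv S↭[a] =
  noSplit [ a ] [ a ] (refl ∷ []⊆ A) S⊆B (s≤s z≤n) 1<|A| (s≤s z≤n)
    (subst (1 <_) (↭-length σ) 1<|A|) refl

no-diffs⇒diagonal : ∀ P → concatMap leftDiff P ≡ [] → concatMap rightDiff P ≡ [] →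
  map proj₁ P ≡ map proj₂ P
no-diffs⇒diagonal [] _ _ = refl
no-diffs⇒diagonal ((a , b) ∷ P) l r
  with ++-empty (diffIfGt a b) l | ++-empty (diffIfGt b a) r
... | la , lP | rb , rP =
  cong₂ _∷_ (≤-antisym (diffIfGt-empty la) (diffIfGt-empty rb)) (no-diffs⇒diagonal P lP rP)

-- In a balanced pair, one side is empty only if the other is (all entries
-- are positive and the sums agree); so a balanced pair whose sides are not
-- both empty has two nonempty sides.
Balanced-empty : ∀ {k C D} → Balanced k C D → C ≡ [] → D ≡ []
Balanced-empty bal refl = positive-sum-zero (positiveB bal) (sym (sums bal))
  where
  positive-sum-zero : ∀ {L : List ℕ} → All (0 <_) L → sum L ≡ 0 → L ≡ []
  positive-sum-zero []             _ = refl
  positive-sum-zero (s≤s _ ∷ _) ()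

Balanced-nonempty : ∀ {k C D} → Balanced k C D → ¬ (C ≡ [] × D ≡ []) → 0 < length C × 0 < length D
Balanced-nonempty bal notBoth =
  nonempty bal notBoth , nonempty (Balanced-sym bal) (λ (d , c) → notBoth (c , d))
  where
  nonempty : ∀ {k L M} → Balanced k L M → ¬ (L ≡ [] × M ≡ []) → 0 < length L
  nonempty {L = []}    bal' notBoth' = ⊥-elim (notBoth' (refl , Balanced-empty bal' refl))
  nonempty {L = _ ∷ _} _    _        = s≤s z≤n

1<n-of-2<n+n : ∀ {n} → 2 < n + n → 1 < n
1<n-of-2<n+n {suc zero}    (s≤s (s≤s ()))
1<n-of-2<n+n {suc (suc _)} _ = s≤s (s≤s z≤n)

-- Deriving along P cannot empty both sides when |A| + |B| > 2: then A₀ and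
-- B₀ are empty and P is diagonal, so A is a rearrangement of B with at
-- least two elements.
derived-not-both-empty : ∀ {A B} P A₀ B₀ → NoProperSplit A B → 2 < length A + length B →
  A ↭ map proj₁ P ++ A₀ → B ↭ map proj₂ P ++ B₀ →
  ¬ (A₀ ++ concatMap leftDiff P ≡ [] × B₀ ++ concatMap rightDiff P ≡ [])
derived-not-both-empty {A} {B} P A₀ B₀ noSplit big σA σB (emptyC , emptyD)
  with refl , noLeft  ← ++-empty A₀ emptyC
     | refl , noRight ← ++-empty B₀ emptyD =
  rearrangement-splits noSplit A↭B
    (1<n-of-2<n+n (subst (λ l → 2 < length A + l) (sym (↭-length A↭B)) big))
  where
  A↭B : A ↭ B
  A↭B = ↭-trans σA (↭-trans (↭-reflexive (cong (_++ []) (no-diffs⇒diagonal P noLeft noRight)))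
                            (↭-sym σB))

derived-kIrreducible : ∀ {k A B C D} P A₀ B₀ → KIrreducible k A B →
  2 < length A + length B →
  A ↭ map proj₁ P ++ A₀ → B ↭ map proj₂ P ++ B₀ →
  C ↭ A₀ ++ concatMap leftDiff P → D ↭ B₀ ++ concatMap rightDiff P →
  KIrreducible k C D
derived-kIrreducible {k} {A} {B} {C} {D} P A₀ B₀ kirr big σA σB σC σD =
  Balanced⇒KIrreducible balCD (proj₁ nonemptyCD) (proj₂ nonemptyCD)
  where
  bal : Balanced k A B
  bal = KIrreducible⇒Balanced kirr
  balCD : Balanced k C D
  balCD = Balanced-↭ (derive-many P A₀ B₀ bal σA σB) (↭-sym σC) (↭-sym σD)
  nonemptyCD : 0 < length C × 0 < length D
  nonemptyCD = Balanced-nonempty balCD λ (c , d) →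
    derived-not-both-empty P A₀ B₀ (noSplit bal) big σA σB
      ( ↭-empty-inv (↭-trans (↭-sym σC) (↭-reflexive c))
      , ↭-empty-inv (↭-trans (↭-sym σD) (↭-reflexive d)))

concatMap-const-[] : (xs : List X) → concatMap (λ _ → [] {A = Y}) xs ≡ []
concatMap-const-[] []       = refl
concatMap-const-[] (_ ∷ xs) = concatMap-const-[] xs

concatMap-↭ : ∀ (f : X → List Y) {xs ys} → xs ↭ ys → concatMap f xs ↭ concatMap f ys
concatMap-↭ f refl          = ↭-refl
concatMap-↭ f (prep x p)    = ++⁺ˡ (f x) (concatMap-↭ f p)
concatMap-↭ f (swap x y p)  = ↭-trans (shifts (f x) (f y)) (++⁺ˡ (f y) (++⁺ˡ (f x) (concatMap-↭ f p)))
concatMap-↭ f (trans p q)   = ↭-trans (concatMap-↭ f p) (concatMap-↭ f q)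

concatMap-++-↭ : ∀ (f g : X → List Y) xs →
  concatMap (λ x → f x ++ g x) xs ↭ concatMap f xs ++ concatMap g xs
concatMap-++-↭ f g []       = ↭-refl
concatMap-++-↭ f g (x ∷ xs) =
  ↭-trans (↭-reflexive (++-assoc (f x) (g x) _))
    (↭-trans (++⁺ˡ (f x) (↭-trans (++⁺ˡ (g x) (concatMap-++-↭ f g xs)) (shifts (g x) (concatMap f xs))))
      (↭-reflexive (sym (++-assoc (f x) (concatMap f xs) _))))

concatMap-comm : ∀ (h : X → Y → List Z) xs ys →
  concatMap (λ x → concatMap (h x) ys) xs ↭ concatMap (λ y → concatMap (λ x → h x y) xs) ys
concatMap-comm h []       ys = ↭-reflexive (sym (concatMap-const-[] ys))
concatMap-comm h (x ∷ xs) ys =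
  ↭-trans (++⁺ˡ (concatMap (h x) ys) (concatMap-comm h xs ys))
    (↭-sym (concatMap-++-↭ (h x) (λ y → concatMap (λ x' → h x' y) xs) ys))

concatMap-concatMap : ∀ (f : Y → List Z) (g : X → List Y) xs →
  concatMap f (concatMap g xs) ≡ concatMap (λ x → concatMap f (g x)) xs
concatMap-concatMap f g []       = refl
concatMap-concatMap f g (x ∷ xs) =
  ≡-trans (concatMap-++ f (g x) (concatMap g xs)) (cong (concatMap f (g x) ++_) (concatMap-concatMap f g xs))

concatMap-replicate : ∀ (f : X → List Z) c (t : Y) r →
  concatMap f (replicate r c) ≡ concatMap (λ _ → f c) (replicate r t)
concatMap-replicate f c t zero    = refl
concatMap-replicate f c t (suc r) = cong (f c ++_) (concatMap-replicate f c t r)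

replicate-+ : ∀ (c : Y) r s → replicate (r + s) c ≡ replicate r c ++ replicate s c
replicate-+ c zero    s = refl
replicate-+ c (suc r) s = cong (c ∷_) (replicate-+ c r s)

concatMap-replicate-sum : ∀ (w : X → ℕ) (c : Y) xs →
  concatMap (λ x → replicate (w x) c) xs ≡ replicate (sum (map w xs)) c
concatMap-replicate-sum w c []       = refl
concatMap-replicate-sum w c (x ∷ xs) =
  ≡-trans (cong (replicate (w x) c ++_) (concatMap-replicate-sum w c xs)) (sym (replicate-+ c (w x) _))

replicates-split : (c : X → Y) (x s : X → ℕ) → (∀ i → s i ≤ x i) → ∀ I →
  concatMap (λ i → replicate (x i) (c i)) I ↭
  concatMap (λ i → replicate (s i) (c i)) I ++ concatMap (λ i → replicate (x i ∸ s i) (c i)) I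
replicates-split c x s s≤x I =
  ↭-trans (↭-reflexive (concatMap-cong (λ i →
             ≡-trans (cong (λ r → replicate r (c i)) (sym (m+[n∸m]≡n (s≤x i))))
                     (replicate-+ (c i) (s i) (x i ∸ s i))) I))
          (concatMap-++-↭ (λ i → replicate (s i) (c i)) (λ i → replicate (x i ∸ s i) (c i)) I)

pairs : ∀ {n m} → (Fin n → ℕ) → (Fin m → ℕ) → (Fin n → Fin m → ℕ) → List (ℕ × ℕ)
pairs {n} {m} a b w = concatMap (λ i → concatMap (λ j → replicate (w i j) (a i , b j)) (allFin m)) (allFin n)

remainder : ∀ {n m} → (a x : Fin n → ℕ) → (Fin n → Fin m → ℕ) → List ℕ
remainder {n} {m} a x w = concatMap (λ i → replicate (x i ∸ ΣFin m (w i)) (a i)) (allFin n)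

map-pairs : ∀ {n m} (f : ℕ × ℕ → X) (a : Fin n → ℕ) (b : Fin m → ℕ) (w : Fin n → Fin m → ℕ) →
  map f (pairs a b w) ≡
  concatMap (λ i → concatMap (λ j → replicate (w i j) (f (a i , b j))) (allFin m)) (allFin n)
map-pairs {n = n} {m = m} f a b w =
  ≡-trans (map-concatMap f _ (allFin n)) (concatMap-cong (λ i →
    ≡-trans (map-concatMap f _ (allFin m)) (concatMap-cong (λ j →
      map-replicate f (w i j) (a i , b j)) (allFin m))) (allFin n))

mset-split : ∀ {n m} (a x : Fin n → ℕ) (b : Fin m → ℕ) (w : Fin n → Fin m → ℕ) → (∀ i → ΣFin m (w i) ≤ x i) →
  mset a x ↭ map proj₁ (pairs a b w) ++ remainder a x w
mset-split {n} {m} a x b w bounded =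
  ↭-trans (replicates-split a x (λ i → ΣFin m (w i)) bounded (allFin n))
    (++⁺ʳ (remainder a x w) (↭-reflexive (sym (≡-trans (map-pairs proj₁ a b w)
      (concatMap-cong (λ i → concatMap-replicate-sum (w i) (a i) (allFin m)) (allFin n))))))

derivedC-split : ∀ {n m} (a x : Fin n → ℕ) (b : Fin m → ℕ) (w : Fin n → Fin m → ℕ) →
  derivedC a x b w ≡ remainder a x w ++ concatMap leftDiff (pairs a b w)
derivedC-split {n} {m} a x b w = cong (remainder a x w ++_) (sym (
  ≡-trans (concatMap-concatMap leftDiff _ (allFin n)) (concatMap-cong (λ i →
    ≡-trans (concatMap-concatMap leftDiff _ (allFin m)) (concatMap-cong (λ j →
      concatMap-replicate leftDiff (a i , b j) 0 (w i j)) (allFin m))) (allFin n))))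

pairs-transpose : ∀ {n m} (a : Fin n → ℕ) (b : Fin m → ℕ) (w : Fin n → Fin m → ℕ) →
  pairs b a (λ j i → w i j) ↭ map swap-pair (pairs a b w)
pairs-transpose {n} {m} a b w =
  ↭-trans (concatMap-comm (λ j i → replicate (w i j) (b j , a i)) (allFin m) (allFin n))
    (↭-reflexive (sym (map-pairs swap-pair a b w)))

transposed-sides : ∀ {P Q : List (ℕ × ℕ)} → Q ↭ map swap-pair P →
  map proj₁ Q ↭ map proj₂ P × concatMap leftDiff Q ↭ concatMap rightDiff P
transposed-sides {P} σ =
  ↭-trans (map⁺ proj₁ σ) (↭-reflexive (sym (map-∘ P))) ,
  ↭-trans (concatMap-↭ leftDiff σ) (↭-reflexive (concatMap-map leftDiff swap-pair P))

∧-sound : ∀ {S T : Set} (s? : Dec S) (t? : Dec T) → does s? ∧ does t? ≡ true → S × T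
∧-sound (yes s) (yes t) _ = s , t

inRange?-sound : ∀ {n} (p q i : Fin n) → inRange? p q i ≡ true → InRange p q i
inRange?-sound p q i e with i<1+q , p<1+i ← ∧-sound (toℕ i <? suc (toℕ q)) (toℕ p <? suc (toℕ i)) e =
  ≤-pred p<1+i , ≤-pred i<1+q

sum-zeros : ∀ (f : X → ℕ) xs → (∀ x → f x ≡ 0) → sum (map f xs) ≡ 0
sum-zeros f []       _    = refl
sum-zeros f (x ∷ xs) zeros rewrite zeros x = sum-zeros f xs zeros

bound-everywhere : ∀ {n} (p q : Fin n) (s x : Fin n → ℕ) →
  (∀ i → inRange? p q i ≡ false → s i ≡ 0) → (∀ i → InRange p q i → s i ≤ x i) → ∀ i → s i ≤ x i
bound-everywhere p q s x outside inside i with inRange? p q i in e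
... | true  = inside i (inRange?-sound p q i e)
... | false = subst (_≤ x i) (sym (outside i e)) z≤n

zR-row-outside : ∀ {n m} p q u v (z : Fin n → Fin m → ℕ) i →
  inRange? p q i ≡ false → ΣFin m (zR p q u v z i) ≡ 0
zR-row-outside {m = m} p q u v z i e = sum-zeros _ (allFin m) zero-entry
  where
  zero-entry : ∀ j → zR p q u v z i j ≡ 0
  zero-entry j rewrite e = refl

zR-col-outside : ∀ {n m} p q u v (z : Fin n → Fin m → ℕ) j →
  inRange? u v j ≡ false → ΣFin n (λ i → zR p q u v z i j) ≡ 0
zR-col-outside {n} p q u v z j e = sum-zeros _ (allFin n) zero-entry
  where
  zero-entry : ∀ i → zR p q u v z i j ≡ 0
  zero-entry i rewrite e with inRange? p q i
  ... | true  = refl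
  ... | false = refl

lemma1 : (k n m : ℕ) (a x : Fin n → ℕ) (b y : Fin m → ℕ) →
    0 < k →
    (∀ i i' → a i ≡ a i' → i ≡ i') →
    (∀ j j' → b j ≡ b j' → j ≡ j') →
    (∀ i → 1 ≤ a i × a i ≤ k) →
    (∀ j → 1 ≤ b j × b j ≤ k) →
    (∀ i → 0 < x i) →
    (∀ j → 0 < y j) →
    KIrreducible k (mset a x) (mset b y) →
    2 < length (mset a x) + length (mset b y) →
    ((i : Fin n) (j : Fin m) (C D : List ℕ) →
       Derived1 (a i) (b j) (mset a x) (mset b y) C D → KIrreducible k C D)
    ×
    ((p q : Fin n) (u v : Fin m) (z : Fin n → Fin m → ℕ) →
       toℕ p ≤ toℕ q → toℕ u ≤ toℕ v →
       (∀ i → InRange p q i → ΣFin m (zR p q u v z i) ≤ x i) →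
       (∀ j → InRange u v j → ΣFin n (λ i → zR p q u v z i j) ≤ y j) →
       (C D : List ℕ) → DerivedProd a x b y p q u v z C D → KIrreducible k C D)
lemma1 k n m a x b y _ _ _ _ _ _ _ kirr big = single , indexed
  where
  single : (i : Fin n) (j : Fin m) (C D : List ℕ) →
    Derived1 (a i) (b j) (mset a x) (mset b y) C D → KIrreducible k C D
  single i j C D (A₀ , B₀ , σA , σB , σC , σD) =
    derived-kIrreducible [ (a i , b j) ] A₀ B₀ kirr big σA σB
      (↭-trans σC (↭-reflexive (cong (A₀ ++_) (sym (++-identityʳ _)))))
      (↭-trans σD (↭-reflexive (cong (B₀ ++_) (sym (++-identityʳ _)))))
  indexed : (p q : Fin n) (u v : Fin m) (z : Fin n → Fin m → ℕ) →
    toℕ p ≤ toℕ q → toℕ u ≤ toℕ v →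
    (∀ i → InRange p q i → ΣFin m (zR p q u v z i) ≤ x i) →
    (∀ j → InRange u v j → ΣFin n (λ i → zR p q u v z i j) ≤ y j) →
    (C D : List ℕ) → DerivedProd a x b y p q u v z C D → KIrreducible k C D
  indexed p q u v z _ _ rowsIn colsIn C D (σC , σD) =
    derived-kIrreducible (pairs a b w) (remainder a x w) (remainder b y wᵀ) kirr big
      (mset-split a x b w rows)
      (↭-trans (mset-split b y a wᵀ cols) (++⁺ʳ _ firsts))
      (↭-trans σC (↭-reflexive (derivedC-split a x b w)))
      (↭-trans σD (↭-trans (↭-reflexive (derivedC-split b y a wᵀ)) (++⁺ˡ _ diffs)))
    where
    w : Fin n → Fin m → ℕ
    w = zR p q u v z
    wᵀ : Fin m → Fin n → ℕ
    wᵀ j i = w i j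
    rows : ∀ i → ΣFin m (w i) ≤ x i
    rows = bound-everywhere p q (λ i → ΣFin m (w i)) x (zR-row-outside p q u v z) rowsIn
    cols : ∀ j → ΣFin n (λ i → w i j) ≤ y j
    cols = bound-everywhere u v (λ j → ΣFin n (λ i → w i j)) y (zR-col-outside p q u v z) colsIn
    firsts : map proj₁ (pairs b a wᵀ) ↭ map proj₂ (pairs a b w)
    firsts = proj₁ (transposed-sides (pairs-transpose a b w))
    diffs : concatMap leftDiff (pairs b a wᵀ) ↭ concatMap rightDiff (pairs a b w)
    diffs = proj₂ (transposed-sides (pairs-transpose a b w))
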